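{- Let $F$ be a field, let $d\ge 3$, and let $H$ be a connected interval $d$-uniform hypergraph on vertex set $[n]$. Then $$\mathrm{M}(H)=\mathrm{Z}_0(H)=\begin{cases}1 & \text{if } d \text{ divides } n-1 \text{ and } H=SI_{d,(n-1)/d},\\ 0 & \text{otherwise.}\end{cases}$$
   Context: An interval $d$-hypergraph here has vertex set $[n]$ and every edge is of the form $\{\ell,\ell+1,\dots,\ell+d-1\}$ for some $\ell\in\{1,\dots,n-d+1\}$; it is determined by $n$ and its left endpoint set $L(H)$ of such $\ell$. A path is an alternating sequence $v_1,e_1,v_2,\dots,e_s,v_{s+1}$ of distinct vertices and distinct edges with $v_i,v_{i+1}\in e_i$; $H$ is connected if any two vertices are joined by a path. For integers $d\ge 2$, $s\ge1$, the special interval hypergraph $SI_{d,s}$ is the interval $d$-hypergraph with $n=sd+1$ vertices and left endpoint set $\{(i-1)d+1,(i-1)d+2: i=1,\dots,s\}$. $\mathrm{M}(H)$: a $d$-hypermatrix $A=[a_{i_1\cdots i_d}]\in F^{n\times\cdots\times n}$ is graphical if symmetric under all permutations of indices and $a_{i_1\cdots i_d}=0$ whenever the indices are not all distinct; $\mathcal{S}(H)$ is the set of graphical $A$ with $a_{i_1\cdots i_d}\ne0$ iff $\{i_1,\dots,i_d\}\in E(H)$. $x\in F^n$ is a null vector of $A$ if $\sum_{j=1}^n a_{i_1\cdots i_{d-1}j}x_j=0$ for all $(i_1,\dots,i_{d-1})\in[n]^{d-1}$; $\operatorname{null}A$ is the dimension of the null space, $\mathrm{M}(H)=\max\{\operatorname{null}A:A\in\mathcal{S}(H)\}$.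 $\mathrm{Z}_0(H)$: with a set $B$ initially blue, others white, a set $S$ of $d-1$ distinct vertices (not necessarily blue) can turn a white $w$ blue if $S\cup\{w\}\in E(H)$ and every white $u$ with $S\cup\{u\}\in E(H)$ equals $w$. $\mathrm{Z}_0(H)$ is the minimum size of a set $B$ from which repeated application colors all vertices blue. -}

module Defs where

open import Level using (Level; _⊔_) renaming (suc to lsuc)
open import Data.Nat using (ℕ; zero; suc; _∸_; _≤_; _<_; _<?_)
  renaming (_+_ to _+ℕ_; _*_ to _*ℕ_)
open import Data.Fin using (Fin; toℕ; fromℕ<; fromℕ; inject₁)
  renaming (zero to fzero; suc to fsuc)
open import Data.Fin.Subset using (Subset; _∈_; _∉_; _∪_; ⁅_⁆; ∣_∣)
open import Data.Fin.Permutation using (Permutation′; _⟨$⟩ʳ_)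
open import Data.Bool using (Bool; true)
open import Data.Product using (Σ; ∃; _×_; _,_)
open import Data.Sum using (_⊎_)
open import Relation.Nullary using (¬_; yes; no)
open import Relation.Binary.PropositionalEquality using (_≡_)
open import Function using (_∘_)
open import Function.Definitions using (Injective)
open import Function.Bundles using (_⇔_)
open import Algebra.Bundles using (CommutativeRing)

record Field (c ℓ : Level) : Set (lsuc (c ⊔ ℓ)) where
  field
    commutativeRing : CommutativeRing c ℓ
  open CommutativeRing commutativeRing public
  field
    0≉1     : ¬ (0# ≈ 1#)
    inverse : ∀ x → ¬ (x ≈ 0#) → ∃ λ y → (x * y) ≈ 1#

-- Interval d-hypergraphs.
-- Vertices are Fin n; the element v : Fin n stands for the vertex
-- toℕ v + 1 ∈ [n].  Left endpoints ℓ are 1-based, as in the paper.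

record IntervalHypergraph (d : ℕ) : Set where
  field
    n       : ℕ
    L       : ℕ → Bool
    L-valid : ∀ ℓ → L ℓ ≡ true → 1 ≤ ℓ × ℓ +ℕ d ≤ n +ℕ 1
open IntervalHypergraph public

InEdge : ∀ {n} (d ℓ : ℕ) → Fin n → Set
InEdge d ℓ v = ℓ ≤ suc (toℕ v) × suc (toℕ v) < ℓ +ℕ d

IsEdge : ∀ {d} (H : IntervalHypergraph d) → (Fin (n H) → Set) → Set
IsEdge {d} H P = ∃ λ ℓ → L H ℓ ≡ true × (∀ v → P v ⇔ InEdge d ℓ v)

Image : ∀ {k m} → (Fin k → Fin m) → Fin m → Set
Image i v = ∃ λ k → i k ≡ v

record Path {d} (H : IntervalHypergraph d) (u w : Fin (n H)) : Set where
  field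
    s      : ℕ
    vtx    : Fin (suc s) → Fin (n H)
    edg    : Fin s → ℕ              -- edges given by their left endpoints
    vtx-inj : Injective _≡_ _≡_ vtx
    edg-inj : Injective _≡_ _≡_ edg
    edg-in  : ∀ i → L H (edg i) ≡ true
    incid   : ∀ i → InEdge d (edg i) (vtx (inject₁ i))
                  × InEdge d (edg i) (vtx (fsuc i))
    start   : vtx fzero ≡ u
    end     : vtx (fromℕ s) ≡ w

Connected : ∀ {d} → IntervalHypergraph d → Set
Connected H = ∀ u w → Path H u w

-- Special interval hypergraph SI_{d,s}
-- (also meaningful for s = 0: one vertex, no edges)

SIL : ℕ → ℕ → ℕ → Set
SIL d s ℓ = ∃ λ j → j < s × (ℓ ≡ j *ℕ d +ℕ 1 ⊎ ℓ ≡ j *ℕ d +ℕ 2)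

IsSpecial : ∀ {d} → IntervalHypergraph d → Set
IsSpecial {d} H = ∃ λ s → n H ≡ s *ℕ d +ℕ 1 × (∀ ℓ → (L H ℓ ≡ true) ⇔ SIL d s ℓ)

module _ {c ℓ'} (F : Field c ℓ') where
  open Field F

  sumF : ∀ {m} → (Fin m → Carrier) → Carrier
  sumF {zero}  f = 0#
  sumF {suc m} f = f fzero + sumF (f ∘ fsuc)

  Hypermatrix : ℕ → ℕ → Set c
  Hypermatrix d m = (Fin d → Fin m) → Carrier

  Graphical : ∀ {d m} → Hypermatrix d m → Set ℓ'
  Graphical {d} A =
    (∀ (i : Fin d → Fin _) (σ : Permutation′ d) → A (i ∘ (σ ⟨$⟩ʳ_)) ≈ A i)
    × (∀ i → ¬ Injective _≡_ _≡_ i → A i ≈ 0#)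

  InS : ∀ {d} (H : IntervalHypergraph d) → Hypermatrix d (n H) → Set ℓ'
  InS H A = Graphical A × (∀ i → (¬ (A i ≈ 0#)) ⇔ IsEdge H (Image i))

  extend : ∀ {d m} → (Fin (d ∸ 1) → Fin m) → Fin m → Fin d → Fin m
  extend {d} i j k with toℕ k <? d ∸ 1
  ... | yes p = i (fromℕ< p)
  ... | no _  = j

  IsNullVector : ∀ {d m} → Hypermatrix d m → (Fin m → Carrier) → Set ℓ'
  IsNullVector {d} A x =
    ∀ (i : Fin (d ∸ 1) → Fin _) → sumF (λ j → A (extend i j) * x j) ≈ 0#

  LinIndep : ∀ {k m} → (Fin k → Fin m → Carrier) → Set (c ⊔ ℓ')
  LinIndep vs = ∀ (a : Fin _ → Carrier) →
    (∀ j → sumF (λ t → a t * vs t j) ≈ 0#) → ∀ t → a t ≈ 0#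

  NullAtLeast : ∀ {d m} → Hypermatrix d m → ℕ → Set (c ⊔ ℓ')
  NullAtLeast A k = Σ (Fin k → Fin _ → Carrier) λ vs →
    (∀ t → IsNullVector A (vs t)) × LinIndep vs

  NullityIs : ∀ {d m} → Hypermatrix d m → ℕ → Set (c ⊔ ℓ')
  NullityIs A k = NullAtLeast A k × (∀ k' → NullAtLeast A k' → k' ≤ k)

  MaxNullityIs : ∀ {d} → IntervalHypergraph d → ℕ → Set (c ⊔ ℓ')
  MaxNullityIs H k =
    (∃ λ A → InS H A × NullityIs A k)
    × (∀ A → InS H A → ∀ k' → NullityIs A k' → k' ≤ k)

module _ {d} (H : IntervalHypergraph d) where

  AddV : (Fin (d ∸ 1) → Fin (n H)) → Fin (n H) → Fin (n H) → Set
  AddV S w v = Image S v ⊎ v ≡ w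

  Forces : Subset (n H) → (Fin (d ∸ 1) → Fin (n H)) → Fin (n H) → Set
  Forces B S w =
    Injective _≡_ _≡_ S × w ∉ B × IsEdge H (AddV S w)
    × (∀ u → u ∉ B → IsEdge H (AddV S u) → u ≡ w)

  data ColorsAll : Subset (n H) → Set where
    done  : ∀ {B} → (∀ v → v ∈ B) → ColorsAll B
    force : ∀ {B} S w → Forces B S w → ColorsAll (B ∪ ⁅ w ⁆) → ColorsAll B

  ZeroForcingIs : ℕ → Set
  ZeroForcingIs k =
    (∃ λ B → ∣ B ∣ ≡ k × ColorsAll B)
    × (∀ B → ColorsAll B → k ≤ ∣ B ∣)

-- The incidence hypermatrix of H (1 on edges, 0 elsewhere) lies in S(H).  A null vector of any
-- A ∈ S(H) that vanishes on a zero-forcing set vanishes everywhere, since a force S → w turns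
-- the null equation of the row S into A(S, w) x_w = 0; this gives M(H) ≤ Z₀(H) in the two forms
-- needed.  To force H, always force the smallest white vertex w by an edge containing w that
-- starts before it: the only other edge through the remaining d - 1 vertices would add a vertex
-- before that edge, which is blue.  Such an edge exists by connectivity unless w is the first
-- vertex; then we walk through H block by block: while H agrees with SI_{d,j} up to vertex
-- j d + 1, that vertex can be forced or H agrees with SI_{d,j+1}, and a walk reaching vertex n
-- means H is special.  So ∅ forces a non-special H and {1} forces SI_{d,s}, whose incidence
-- hypermatrix has the null vector with alternating signs ±1 at the joints 1, d + 1, 2d + 1, …
-- and 0 elsewhere.

module Submission where

open import Defs
open import Level using (Level)
open import Data.Nat using (ℕ; zero; suc; _≤_; _<_; z≤n; s≤s; _≤?_; _<?_)
open import Data.Nat.Properties using (<-irrefl; <⇒≱; ≰⇒>)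
open import Data.Fin as Fin
  using (Fin; toℕ; fromℕ<; fromℕ; inject₁; punchIn; punchOut)
  renaming (zero to fzero; suc to fsuc)
open import Data.Fin.Properties
  using (toℕ-injective; toℕ<n; toℕ-fromℕ<; toℕ-fromℕ; toℕ-inject₁; toℕ-inject; suc-injective;
         punchIn-injective; punchInᵢ≢i; punchIn-punchOut; injective⇒≤; any?; all?; ¬∀⟶∃¬-smallest)
open import Data.Fin.Subset as Subset using (Subset; _∈_; _∉_; _∪_; ⁅_⁆; ∣_∣)
open import Data.Fin.Subset.Properties
  using (_∈?_; ∉⊥; ∣⊥∣≡0; ∣⁅x⁆∣≡1; x∈⁅x⁆; x∈⁅y⁆⇒x≡y; x∈p∪q⁻; x∈p∪q⁺; p⊆p∪q;
         ∣p∣≤n; p⊂q⇒∣p∣<∣q∣; p⊆q⇒∣p∣≤∣q∣; nonempty?)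
open import Data.Fin.Permutation using (Permutation′; _⟨$⟩ʳ_; _⟨$⟩ˡ_; inverseʳ)
open import Data.Bool as Bool using (true)
open import Data.Product using (Σ; ∃; _×_; _,_; proj₁; proj₂; uncurry)
open import Data.Sum using (_⊎_; inj₁; inj₂; [_,_]; map₂)
open import Data.Empty using (⊥; ⊥-elim)
open import Relation.Nullary using (¬_; Dec; yes; no; _×-dec_; _⊎-dec_; _→-dec_)
open import Relation.Nullary.Decidable using (map′)
open import Relation.Binary.Definitions using (tri<; tri≈; tri>)
open import Relation.Binary.PropositionalEquality as ≡ using (_≡_; _≢_; refl; cong; subst)
open import Function using (_∘_)
open import Function.Bundles using (_⇔_; mk⇔; Equivalence)
open import Function.Properties.Equivalence using () renaming (sym to ⇔-sym; trans to ⇔-trans)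
open import Function.Definitions using (Injective)
import Algebra.Properties.Ring as RingProperties
import Algebra.Properties.CommutativeSemigroup as CommutativeSemigroupProperties

¬¬-∀-Fin : ∀ {m a} {Q : Fin m → Set a} → (∀ j → ¬ ¬ Q j) → ¬ ¬ (∀ j → Q j)
¬¬-∀-Fin {zero}          h ¬q = ¬q (λ ())
¬¬-∀-Fin {suc m} {Q = Q} h ¬q =
  h fzero λ q₀ → ¬¬-∀-Fin {Q = Q ∘ fsuc} (h ∘ fsuc) λ qs →
  ¬q λ { fzero → q₀ ; (fsuc j) → qs j }

_⇔?_ : ∀ {a b} {A : Set a} {B : Set b} → Dec A → Dec B → Dec (A ⇔ B)
a? ⇔? b? = map′ (uncurry mk⇔) (λ eq → Equivalence.to eq , Equivalence.from eq)
  ((a? →-dec b?) ×-dec (b? →-dec a?))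

no-injection-into-image : ∀ {e m} (i : Fin e → Fin m) (g : Fin (suc e) → Fin m) →
  Injective _≡_ _≡_ g → ¬ (∀ t → Image i (g t))
no-injection-into-image i g g-inj img = <-irrefl refl (injective⇒≤ {f = preimage} preimage-inj)
  where
  preimage : Fin _ → Fin _
  preimage t = proj₁ (img t)
  preimage-inj : Injective _≡_ _≡_ preimage
  preimage-inj {t₁} {t₂} eq = g-inj (≡.trans (≡.sym (proj₂ (img t₁))) (≡.trans (cong i eq) (proj₂ (img t₂))))

step-across : ∀ y s (f : Fin (suc s) → ℕ) → f fzero ≤ y → y < f (fromℕ s) →
  ∃ λ (i : Fin s) → f (inject₁ i) ≤ y × y < f (fsuc i)
step-across y zero    f f₀≤y y<fₛ = ⊥-elim (<⇒≱ y<fₛ f₀≤y)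
step-across y (suc s) f f₀≤y y<fₛ with f (fsuc fzero) ≤? y
... | no f₁≰y = fzero , f₀≤y , ≰⇒> f₁≰y
... | yes f₁≤y with step-across y s (f ∘ fsuc) f₁≤y y<fₛ
...   | i , before , after = fsuc i , before , after

smallest-outside : ∀ {m} (B : Subset m) → ¬ (∀ v → v ∈ B) →
  ∃ λ w → w ∉ B × (∀ u → toℕ u < toℕ w → u ∈ B)
smallest-outside {m} B ¬all with ¬∀⟶∃¬-smallest m (_∈ B) (_∈? B) ¬all
... | w , w∉B , below-in = w , w∉B , λ u u<w →
  subst (_∈ B) (toℕ-injective (≡.trans (toℕ-inject (fromℕ< u<w)) (toℕ-fromℕ< u<w))) (below-in (fromℕ< u<w))

∣p∣<∣p∪⁅x⁆∣ : ∀ {m} {p : Subset m} {x} → x ∉ p → ∣ p ∣ < ∣ p ∪ ⁅ x ⁆ ∣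
∣p∣<∣p∪⁅x⁆∣ {x = x} x∉p = p⊂q⇒∣p∣<∣q∣ (p⊆p∪q ⁅ x ⁆ , x , x∈p∪q⁺ (inj₂ (x∈⁅x⁆ x)) , x∉p)

module FieldFacts {c ℓ : Level} (F : Field c ℓ) where
  open Field F renaming (refl to ≈-refl; sym to ≈-sym; trans to ≈-trans)
  open RingProperties ring using (-‿distribˡ-*)
  open CommutativeSemigroupProperties +-commutativeSemigroup using () renaming (interchange to +-interchange)
  open import Relation.Binary.Reasoning.Setoid setoid

  1≉0 : ¬ (1# ≈ 0#)
  1≉0 = 0≉1 ∘ ≈-sym

  *-annihˡ : ∀ {a} x → a ≈ 0# → a * x ≈ 0#
  *-annihˡ x a≈0 = ≈-trans (*-cong a≈0 ≈-refl) (zeroˡ x)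

  *-annihʳ : ∀ a {x} → x ≈ 0# → a * x ≈ 0#
  *-annihʳ a x≈0 = ≈-trans (*-cong ≈-refl x≈0) (zeroʳ a)

  *-cancel-nonzero : ∀ a x → ¬ (a ≈ 0#) → a * x ≈ 0# → x ≈ 0#
  *-cancel-nonzero a x a≉0 ax≈0 with inverse a a≉0
  ... | y , ay≈1 = begin
    x             ≈⟨ *-identityˡ x ⟨
    1# * x        ≈⟨ *-cong ay≈1 ≈-refl ⟨
    (a * y) * x   ≈⟨ *-cong (*-comm a y) ≈-refl ⟩
    (y * a) * x   ≈⟨ *-assoc y a x ⟩
    y * (a * x)   ≈⟨ *-annihʳ y ax≈0 ⟩
    0#            ∎

  -x*y+y*x≈0 : ∀ x y → (- x) * y + y * x ≈ 0#
  -x*y+y*x≈0 x y = begin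
    (- x) * y + y * x    ≈⟨ +-cong (-‿distribˡ-* x y) (*-comm x y) ⟨
    - (x * y) + x * y    ≈⟨ -‿inverseˡ (x * y) ⟩
    0#                   ∎

  sumF-cong : ∀ {m} {f g : Fin m → Carrier} → (∀ j → f j ≈ g j) → sumF F f ≈ sumF F g
  sumF-cong {zero}  f≈g = ≈-refl
  sumF-cong {suc m} f≈g = +-cong (f≈g fzero) (sumF-cong (f≈g ∘ fsuc))

  sumF-zero : ∀ {m} {f : Fin m → Carrier} → (∀ j → f j ≈ 0#) → sumF F f ≈ 0#
  sumF-zero {zero}  f≈0 = ≈-refl
  sumF-zero {suc m} f≈0 = ≈-trans (+-cong (f≈0 fzero) (sumF-zero (f≈0 ∘ fsuc))) (+-identityˡ 0#)

  sumF-single : ∀ {m} {f : Fin m → Carrier} w → (∀ j → j ≢ w → f j ≈ 0#) → sumF F f ≈ f w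
  sumF-single fzero    f≈0 =
    ≈-trans (+-cong ≈-refl (sumF-zero λ j → f≈0 (fsuc j) λ ())) (+-identityʳ _)
  sumF-single (fsuc w) f≈0 =
    ≈-trans (+-cong (f≈0 fzero λ ()) (sumF-single w λ j j≢w → f≈0 (fsuc j) (j≢w ∘ suc-injective)))
          (+-identityˡ _)

  sumF-pair : ∀ {m} {f : Fin m → Carrier} a b → a ≢ b →
    (∀ j → j ≢ a → j ≢ b → f j ≈ 0#) → sumF F f ≈ f a + f b
  sumF-pair fzero fzero a≢b _ = ⊥-elim (a≢b refl)
  sumF-pair fzero (fsuc b) _ f≈0 =
    +-cong ≈-refl (sumF-single b λ j j≢b → f≈0 (fsuc j) (λ ()) (j≢b ∘ suc-injective))
  sumF-pair {f = f} (fsuc a) fzero _ f≈0 = begin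
    f fzero + sumF F (f ∘ fsuc)  ≈⟨ +-comm _ _ ⟩
    sumF F (f ∘ fsuc) + f fzero  ≈⟨ +-cong (sumF-single a λ j j≢a → f≈0 (fsuc j) (j≢a ∘ suc-injective) (λ ()))
                                           ≈-refl ⟩
    f (fsuc a) + f fzero         ∎
  sumF-pair (fsuc a) (fsuc b) a≢b f≈0 =
    ≈-trans (+-cong (f≈0 fzero (λ ()) (λ ())) (sumF-pair a b (a≢b ∘ cong fsuc) λ j j≢a j≢b →
                      f≈0 (fsuc j) (j≢a ∘ suc-injective) (j≢b ∘ suc-injective)))
            (+-identityˡ _)

  sumF-+ : ∀ {m} (f g : Fin m → Carrier) → sumF F (λ j → f j + g j) ≈ sumF F f + sumF F g
  sumF-+ {zero}  f g = ≈-sym (+-identityˡ 0#)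
  sumF-+ {suc m} f g = ≈-trans (+-cong ≈-refl (sumF-+ (f ∘ fsuc) (g ∘ fsuc))) (+-interchange _ _ _ _)

  sumF-*ˡ : ∀ {m} a (f : Fin m → Carrier) → sumF F (λ j → a * f j) ≈ a * sumF F f
  sumF-*ˡ {zero}  a f = ≈-sym (zeroʳ a)
  sumF-*ˡ {suc m} a f = ≈-trans (+-cong ≈-refl (sumF-*ˡ a (f ∘ fsuc))) (≈-sym (distribˡ a _ _))

module NullVectors {c ℓ : Level} (F : Field c ℓ) where
  open Field F renaming (refl to ≈-refl; sym to ≈-sym; trans to ≈-trans)
  open FieldFacts F
  open CommutativeSemigroupProperties *-commutativeSemigroup using (x∙yz≈y∙xz)
  open import Relation.Binary.Reasoning.Setoid setoid

  isNullVector-lincomb : ∀ {d m k} (A : Hypermatrix F d m) (a : Fin k → Carrier)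
    (vs : Fin k → Fin m → Carrier) → (∀ t → IsNullVector F A (vs t)) →
    IsNullVector F A (λ j → sumF F (λ t → a t * vs t j))
  isNullVector-lincomb {m = m} {zero}  A a vs null i = sumF-zero {m} λ j → zeroʳ _
  isNullVector-lincomb {m = m} {suc k} A a vs null i = begin
    sumF F (λ j → Aᵢ j * (a₀ * vs fzero j + rest j))           ≈⟨ sumF-cong split ⟩
    sumF F (λ j → a₀ * (Aᵢ j * vs fzero j) + Aᵢ j * rest j)
      ≈⟨ sumF-+ (λ j → a₀ * (Aᵢ j * vs fzero j)) (λ j → Aᵢ j * rest j) ⟩
    sumF F (λ j → a₀ * (Aᵢ j * vs fzero j)) + sumF F (λ j → Aᵢ j * rest j)
      ≈⟨ +-cong (sumF-*ˡ a₀ (λ j → Aᵢ j * vs fzero j))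
                (isNullVector-lincomb A (a ∘ fsuc) (vs ∘ fsuc) (null ∘ fsuc) i) ⟩
    a₀ * sumF F (λ j → Aᵢ j * vs fzero j) + 0#                 ≈⟨ +-identityʳ _ ⟩
    a₀ * sumF F (λ j → Aᵢ j * vs fzero j)                      ≈⟨ *-annihʳ a₀ (null fzero i) ⟩
    0#                                                         ∎
    where
    a₀ : Carrier
    a₀ = a fzero
    Aᵢ : Fin m → Carrier
    Aᵢ j = A (extend F i j)
    rest : Fin m → Carrier
    rest j = sumF F (λ t → a (fsuc t) * vs (fsuc t) j)
    split : ∀ j → Aᵢ j * (a₀ * vs fzero j + rest j) ≈ a₀ * (Aᵢ j * vs fzero j) + Aᵢ j * rest j
    split j = ≈-trans (distribˡ _ _ _) (+-cong (x∙yz≈y∙xz _ _ _) ≈-refl)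

  linIndep⇒head≉0 : ∀ {k m} (vs : Fin (suc k) → Fin m → Carrier) → LinIndep F vs →
    ¬ ¬ (∀ j → vs fzero j ≈ 0#) → ⊥
  linIndep⇒head≉0 vs indep ¬¬head≈0 =
    ¬¬head≈0 λ head≈0 → 1≉0 (indep δ (λ j → δ-combination j (head≈0 j)) fzero)
    where
    δ : Fin _ → Carrier
    δ fzero    = 1#
    δ (fsuc _) = 0#
    δ-combination : ∀ j → vs fzero j ≈ 0# → sumF F (λ t → δ t * vs t j) ≈ 0#
    δ-combination j h =
      ≈-trans (+-cong (≈-trans (*-identityˡ _) h) (sumF-zero λ t → zeroˡ (vs (fsuc t) j))) (+-identityˡ 0#)

  nonzero⇒linIndep : ∀ {m} (x : Fin m → Carrier) v → ¬ (x v ≈ 0#) → LinIndep F (λ (_ : Fin 1) → x)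
  nonzero⇒linIndep x v x_v≉0 a combination≈0 fzero =
    *-cancel-nonzero (x v) (a fzero) x_v≉0
      (≈-trans (*-comm _ _) (≈-trans (≈-sym (+-identityʳ _)) (combination≈0 v)))

  maxNullityIs-intro : ∀ {d k} {H : IntervalHypergraph d} (A : Hypermatrix F d (n H)) → InS F H A →
    NullAtLeast F A k → (∀ A → InS F H A → ∀ k' → NullAtLeast F A k' → k' ≤ k) → MaxNullityIs F H k
  maxNullityIs-intro A A∈S null bound =
    (A , A∈S , null , bound A A∈S) , λ A' A'∈S k' nullity → bound A' A'∈S k' (proj₁ nullity)

module IntervalEdges (e : ℕ) (H : IntervalHypergraph (suc e)) where
  open import Data.Nat using (_+_; _∸_; s≤s⁻¹)
  open import Data.Nat.Properties

  private
    d : ℕ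
    d = suc e
    N : ℕ
    N = n H

  -- Left endpoints are 1-based and vertices 0-based: the edge suc y is the window [y, y + e].
  inEdge-suc⇔ : ∀ y (v : Fin N) → InEdge d (suc y) v ⇔ (y ≤ toℕ v × toℕ v ≤ y + e)
  inEdge-suc⇔ y v = mk⇔
    (λ (y<v , v<end) → s≤s⁻¹ y<v , s≤s⁻¹ (≤-trans (s≤s⁻¹ v<end) (≤-reflexive (+-suc y e))))
    (λ (y≤v , v≤end) → s≤s y≤v , s≤s (≤-trans (s≤s v≤end) (≤-reflexive (≡.sym (+-suc y e)))))

  ¬edge-at-0 : ¬ (L H 0 ≡ true)
  ¬edge-at-0 L0 with proj₁ (L-valid H 0 L0)
  ... | ()

  edge-fits : ∀ b → L H (suc b) ≡ true → b + d ≤ N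
  edge-fits b Lb = s≤s⁻¹ (subst (suc b + d ≤_) (+-comm N 1) (proj₂ (L-valid H (suc b) Lb)))

  edgeVertex : ∀ b → b + d ≤ N → Fin d → Fin N
  edgeVertex b fits j = fromℕ< (≤-trans (+-monoʳ-< b (toℕ<n j)) fits)

  toℕ-edgeVertex : ∀ b fits j → toℕ (edgeVertex b fits j) ≡ b + toℕ j
  toℕ-edgeVertex b fits j = toℕ-fromℕ< _

  edgeVertex-injective : ∀ b fits → Injective _≡_ _≡_ (edgeVertex b fits)
  edgeVertex-injective b fits {i} {j} eq = toℕ-injective (+-cancelˡ-≡ b _ _
    (≡.trans (≡.sym (toℕ-edgeVertex b fits i)) (≡.trans (cong toℕ eq) (toℕ-edgeVertex b fits j))))

  edgeVertex-inEdge : ∀ b fits j → InEdge d (suc b) (edgeVertex b fits j)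
  edgeVertex-inEdge b fits j rewrite toℕ-edgeVertex b fits j = s≤s (m≤m+n b _) , s≤s (+-monoʳ-< b (toℕ<n j))

  inEdge⇒edgeVertex : ∀ b fits v → InEdge d (suc b) v → ∃ λ j → edgeVertex b fits j ≡ v
  inEdge⇒edgeVertex b fits v (s≤s b≤v , s≤s v<b+d) = fromℕ< offset<d , toℕ-injective (begin
      toℕ (edgeVertex b fits (fromℕ< offset<d))  ≡⟨ toℕ-edgeVertex b fits _ ⟩
      b + toℕ (fromℕ< offset<d)                   ≡⟨ cong (b +_) (toℕ-fromℕ< offset<d) ⟩
      b + (toℕ v ∸ b)                             ≡⟨ m+[n∸m]≡n b≤v ⟩
      toℕ v                                       ∎)
    where
    open ≡.≡-Reasoning
    offset<d : toℕ v ∸ b < d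
    offset<d = +-cancelˡ-< b _ _ (subst (_< b + d) (≡.sym (m+[n∸m]≡n b≤v)) v<b+d)

  edge-vertices : ∀ ℓ → L H ℓ ≡ true →
    Σ (Fin d → Fin N) λ g → Injective _≡_ _≡_ g × (∀ t → InEdge d ℓ (g t))
  edge-vertices zero    L0 = ⊥-elim (¬edge-at-0 L0)
  edge-vertices (suc b) Lb = edgeVertex b fits , edgeVertex-injective b fits , edgeVertex-inEdge b fits
    where
    fits : b + d ≤ N
    fits = edge-fits b Lb

  isEdge-resp : ∀ {Q Q' : Fin N → Set} → (∀ v → Q v ⇔ Q' v) → IsEdge H Q → IsEdge H Q'
  isEdge-resp Q⇔Q' (ℓ' , Lℓ' , Q⇔edge) = ℓ' , Lℓ' , λ v → mk⇔
    (Equivalence.to (Q⇔edge v) ∘ Equivalence.from (Q⇔Q' v))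
    (Equivalence.to (Q⇔Q' v) ∘ Equivalence.from (Q⇔edge v))

  inEdge? : ∀ ℓ' (v : Fin N) → Dec (InEdge d ℓ' v)
  inEdge? ℓ' v = (ℓ' ≤? suc (toℕ v)) ×-dec (suc (toℕ v) <? ℓ' + d)

  image? : ∀ {m} (i : Fin m → Fin N) v → Dec (Image i v)
  image? i v = any? λ k → i k Fin.≟ v

  isEdge? : (Q : Fin N → Set) → (∀ v → Dec (Q v)) → Dec (IsEdge H Q)
  isEdge? Q Q? =
    map′ (λ (ℓ' , _ , edge) → ℓ' , edge) (λ (ℓ' , edge) → ℓ' , bounded ℓ' (proj₁ edge) , edge)
      (anyUpTo? (λ ℓ' → (L H ℓ' Bool.≟ true) ×-dec all? (λ v → Q? v ⇔? inEdge? ℓ' v)) (suc N))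
    where
    bounded : ∀ ℓ' → L H ℓ' ≡ true → ℓ' < suc N
    bounded ℓ' Lℓ' = ≤-trans (s≤s (m≤m+n ℓ' e)) (≤-trans (≤-reflexive (≡.sym (+-suc ℓ' e)))
      (subst (ℓ' + d ≤_) (+-comm N 1) (proj₂ (L-valid H ℓ' Lℓ'))))

  isEdge⇒injective : (i : Fin d → Fin N) → IsEdge H (Image i) → Injective _≡_ _≡_ i
  isEdge⇒injective i (ℓ' , Lℓ' , edge) {k₁} {k₂} eq with k₁ Fin.≟ k₂ | edge-vertices ℓ' Lℓ'
  ... | yes k₁≡k₂ | _ = k₁≡k₂
  ... | no k₁≢k₂ | g , g-inj , g-in = ⊥-elim (no-injection-into-image (i ∘ punchIn k₂) g g-inj covered)
    where
    hit : ∀ {v} k → i k ≡ v → Image (i ∘ punchIn k₂) v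
    hit k ik≡v with k Fin.≟ k₂
    ... | no k≢k₂ = punchOut (k≢k₂ ∘ ≡.sym) , ≡.trans (cong i (punchIn-punchOut (k≢k₂ ∘ ≡.sym))) ik≡v
    ... | yes refl =
      punchOut (k₁≢k₂ ∘ ≡.sym) , ≡.trans (cong i (punchIn-punchOut (k₁≢k₂ ∘ ≡.sym))) (≡.trans eq ik≡v)
    covered : ∀ t → Image (i ∘ punchIn k₂) (g t)
    covered t = uncurry hit (Equivalence.from (edge (g t)) (g-in t))

  isEdge-AddV⇒∉image : ∀ (i : Fin e → Fin N) q → IsEdge H (AddV H i q) → ¬ Image i q
  isEdge-AddV⇒∉image i q (ℓ' , Lℓ' , edge) q∈i with edge-vertices ℓ' Lℓ'
  ... | g , g-inj , g-in = no-injection-into-image i g g-inj λ t → shrink (Equivalence.from (edge (g t)) (g-in t))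
    where
    shrink : ∀ {v} → AddV H i q v → Image i v
    shrink (inj₁ v∈i)  = v∈i
    shrink (inj₂ refl) = q∈i

  path-crosses : ∀ {u w} → Path H u w → ∀ y → toℕ u ≤ y → y < toℕ w →
    ∃ λ ℓ' → L H ℓ' ≡ true × ℓ' ≤ suc y × suc (suc y) < ℓ' + d
  path-crosses p y u≤y y<w
    with step-across y (Path.s p) (toℕ ∘ Path.vtx p)
           (subst (_≤ y) (cong toℕ (≡.sym (Path.start p))) u≤y)
           (subst (y <_) (cong toℕ (≡.sym (Path.end p))) y<w)
  ... | i , before , after = Path.edg p i , Path.edg-in p i ,
    ≤-trans (proj₁ (proj₁ (Path.incid p i))) (s≤s before) ,
    ≤-trans (s≤s (s≤s after)) (proj₂ (proj₂ (Path.incid p i)))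

  consecutive-share-edge : Connected H → ∀ y → suc y < N →
    ∃ λ ℓ' → L H ℓ' ≡ true × ℓ' ≤ suc y × suc (suc y) < ℓ' + d
  consecutive-share-edge connected y sy<N =
    path-crosses (connected (fromℕ< (<-trans (n<1+n y) sy<N)) (fromℕ< sy<N)) y
      (≤-reflexive (toℕ-fromℕ< _)) (≤-reflexive (≡.sym (toℕ-fromℕ< _)))

module IncidenceMatrix {c ℓ : Level} (F : Field c ℓ) (e : ℕ) (H : IntervalHypergraph (suc e)) where
  open Field F renaming (refl to ≈-refl; sym to ≈-sym; trans to ≈-trans)
  open FieldFacts F using (1≉0)
  open IntervalEdges e H
  open import Data.Nat.Properties using (<-irrefl)

  private
    d : ℕ
    d = suc e
    N : ℕ
    N = n H

  indicator : ∀ {a} {Q : Set a} → Dec Q → Carrier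
  indicator (yes _) = 1#
  indicator (no _)  = 0#

  incidence : Hypermatrix F d N
  incidence i = indicator (isEdge? (Image i) (image? i))

  incidence-edge : ∀ i → IsEdge H (Image i) → incidence i ≈ 1#
  incidence-edge i edge with isEdge? (Image i) (image? i)
  ... | yes _    = ≈-refl
  ... | no ¬edge = ⊥-elim (¬edge edge)

  incidence-nonedge : ∀ i → ¬ IsEdge H (Image i) → incidence i ≈ 0#
  incidence-nonedge i ¬edge with isEdge? (Image i) (image? i)
  ... | yes edge = ⊥-elim (¬edge edge)
  ... | no _     = ≈-refl

  incidence≉0⇒edge : ∀ i → ¬ (incidence i ≈ 0#) → IsEdge H (Image i)
  incidence≉0⇒edge i ≉0 with isEdge? (Image i) (image? i)
  ... | yes edge = edge
  ... | no _     = ⊥-elim (≉0 ≈-refl)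

  image-permute : ∀ (i : Fin d → Fin N) (σ : Permutation′ d) v → Image (i ∘ (σ ⟨$⟩ʳ_)) v ⇔ Image i v
  image-permute i σ v =
    mk⇔ (λ (k , eq) → σ ⟨$⟩ʳ k , eq) (λ (k , eq) → σ ⟨$⟩ˡ k , ≡.trans (cong i (inverseʳ σ)) eq)

  incidence-graphical : Graphical F incidence
  incidence-graphical = symmetric , vanishes-off-diagonal
    where
    symmetric : ∀ i σ → incidence (i ∘ (σ ⟨$⟩ʳ_)) ≈ incidence i
    symmetric i σ with isEdge? (Image i) (image? i)
    ... | yes edge = incidence-edge _ (isEdge-resp (λ v → ⇔-sym (image-permute i σ v)) edge)
    ... | no ¬edge = incidence-nonedge _ (¬edge ∘ isEdge-resp (image-permute i σ))
    vanishes-off-diagonal : ∀ i → ¬ Injective _≡_ _≡_ i → incidence i ≈ 0#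
    vanishes-off-diagonal i ¬inj = incidence-nonedge i (¬inj ∘ isEdge⇒injective i)

  incidence∈S : InS F H incidence
  incidence∈S = incidence-graphical , λ i →
    mk⇔ (incidence≉0⇒edge i) (λ edge ≈0 → 1≉0 (≈-trans (≈-sym (incidence-edge i edge)) ≈0))

  extend-< : ∀ (i : Fin e → Fin N) j k (k<e : toℕ k < e) → extend F {d} i j k ≡ i (fromℕ< k<e)
  extend-< i j k k<e with toℕ k <? e
  ... | yes _   = refl
  ... | no k≮e = ⊥-elim (k≮e k<e)

  extend-≮ : ∀ (i : Fin e → Fin N) j k → ¬ (toℕ k < e) → extend F {d} i j k ≡ j
  extend-≮ i j k k≮e with toℕ k <? e
  ... | yes k<e = ⊥-elim (k≮e k<e)
  ... | no _    = refl

  image-extend : ∀ (i : Fin e → Fin N) j v → Image (extend F {d} i j) v ⇔ AddV H i j v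
  image-extend i j v = mk⇔ to from
    where
    to : Image (extend F {d} i j) v → AddV H i j v
    to (k , eq) = position (toℕ k <? e)
      where
      position : Dec (toℕ k < e) → AddV H i j v
      position (yes k<e) = inj₁ (fromℕ< k<e , ≡.trans (≡.sym (extend-< i j k k<e)) eq)
      position (no k≮e)  = inj₂ (≡.trans (≡.sym eq) (extend-≮ i j k k≮e))
    from : AddV H i j v → Image (extend F {d} i j) v
    from (inj₁ (k , eq)) =
      inject₁ k , ≡.trans (extend-< i j (inject₁ k) k<e) (≡.trans (cong i inject₁-restricts) eq)
      where
      k<e : toℕ (inject₁ k) < e
      k<e = subst (_< e) (≡.sym (toℕ-inject₁ k)) (toℕ<n k)
      inject₁-restricts : fromℕ< k<e ≡ k
      inject₁-restricts = toℕ-injective (≡.trans (toℕ-fromℕ< k<e) (toℕ-inject₁ k))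
    from (inj₂ refl) = fromℕ e , extend-≮ i j (fromℕ e) (<-irrefl (toℕ-fromℕ e))

  isEdge-extend⇔ : ∀ (i : Fin e → Fin N) j → IsEdge H (Image (extend F {d} i j)) ⇔ IsEdge H (AddV H i j)
  isEdge-extend⇔ i j = mk⇔ (isEdge-resp (image-extend i j)) (isEdge-resp (⇔-sym ∘ image-extend i j))

module ForcingBound {c ℓ : Level} (F : Field c ℓ) (e : ℕ) (H : IntervalHypergraph (suc e)) where
  open Field F renaming (refl to ≈-refl; sym to ≈-sym; trans to ≈-trans)
  open FieldFacts F
  open NullVectors F
  open IncidenceMatrix F e H using (isEdge-extend⇔)

  private
    d : ℕ
    d = suc e
    N : ℕ
    N = n H

  -- Vanishing is double negated since equality in F need not be decidable.
  VanishesOn : (Fin N → Carrier) → Subset N → Set ℓ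
  VanishesOn x B = ∀ v → v ∈ B → ¬ ¬ (x v ≈ 0#)

  module _ (A : Hypermatrix F d N) (A∈S : InS F H A) (x : Fin N → Carrier) (null : IsNullVector F A x) where

    entry≉0⇔edge : ∀ S j → (¬ (A (extend F {d} S j) ≈ 0#)) ⇔ IsEdge H (AddV H S j)
    entry≉0⇔edge S j = mk⇔ (Equivalence.to (isEdge-extend⇔ S j) ∘ Equivalence.to (proj₂ A∈S _))
                           (Equivalence.from (proj₂ A∈S _) ∘ Equivalence.from (isEdge-extend⇔ S j))

    -- In the null equation of the row S only the term of w survives, since every other
    -- white j makes A(S, j) vanish and every blue j has x_j = 0.
    force-vanishes : ∀ {B S w} → Forces H B S w → VanishesOn x B → ¬ ¬ (x w ≈ 0#)
    force-vanishes {B} {S} {w} (_ , _ , edge , unique) x|B x_w≉0 =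
      ¬¬-∀-Fin other-terms λ others →
        x_w≉0 (*-cancel-nonzero _ _ (Equivalence.from (entry≉0⇔edge S w) edge)
                                    (≈-trans (≈-sym (sumF-single w others)) (null S)))
      where
      other-terms : ∀ j → ¬ ¬ (j ≢ w → A (extend F {d} S j) * x j ≈ 0#)
      other-terms j ¬term with j Fin.≟ w | j ∈? B
      ... | yes j≡w | _    = ¬term λ j≢w → ⊥-elim (j≢w j≡w)
      ... | no j≢w | yes j∈B = x|B j j∈B λ x_j≈0 → ¬term λ _ → *-annihʳ _ x_j≈0
      ... | no j≢w | no j∉B  = entry≈0 λ entry≈0 → ¬term λ _ → *-annihˡ (x j) entry≈0
        where
        entry≈0 : ¬ ¬ (A (extend F {d} S j) ≈ 0#)
        entry≈0 entry≉0 = j≢w (unique j j∉B (Equivalence.to (entry≉0⇔edge S j) entry≉0))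

    colorsAll⇒vanishes : ∀ {B} → ColorsAll H B → VanishesOn x B → ∀ v → ¬ ¬ (x v ≈ 0#)
    colorsAll⇒vanishes (done all-blue)        x|B v = x|B v (all-blue v)
    colorsAll⇒vanishes {B} (force S w forces rest) x|B = colorsAll⇒vanishes rest x|B∪w
      where
      x|B∪w : VanishesOn x (B ∪ ⁅ w ⁆)
      x|B∪w v v∈ with x∈p∪q⁻ B ⁅ w ⁆ v∈
      ... | inj₁ v∈B = x|B v v∈B
      ... | inj₂ v∈w = subst (λ u → ¬ ¬ (x u ≈ 0#)) (≡.sym (x∈⁅y⁆⇒x≡y w v∈w)) (force-vanishes forces x|B)

  nullity≤0 : ColorsAll H Subset.⊥ → ∀ A → InS F H A → ∀ k → NullAtLeast F A k → k ≤ 0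
  nullity≤0 colors A A∈S zero    _                   = z≤n
  nullity≤0 colors A A∈S (suc k) (vs , null , indep) = ⊥-elim (linIndep⇒head≉0 vs indep
    (¬¬-∀-Fin (colorsAll⇒vanishes A A∈S (vs fzero) (null fzero) colors λ _ v∈⊥ → ⊥-elim (∉⊥ v∈⊥))))

  -- A combination of two null vectors that vanishes at v vanishes everywhere, so
  -- any two null vectors are proportional.
  nullity≤1 : ∀ v → ColorsAll H ⁅ v ⁆ → ∀ A → InS F H A → ∀ k → NullAtLeast F A k → k ≤ 1
  nullity≤1 v colors A A∈S zero          _                   = z≤n
  nullity≤1 v colors A A∈S (suc zero)    _                   = s≤s z≤n
  nullity≤1 v colors A A∈S (suc (suc k)) (vs , null , indep) =
    ⊥-elim (linIndep⇒head≉0 vs indep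
      (¬¬-∀-Fin (vanishes-from-v (vs fzero) (null fzero) head-vanishes-at-v)))
    where
    vanishes-from-v : ∀ x → IsNullVector F A x → ¬ ¬ (x v ≈ 0#) → ∀ u → ¬ ¬ (x u ≈ 0#)
    vanishes-from-v x null-x x_v≈0 = colorsAll⇒vanishes A A∈S x null-x colors λ u u∈v →
      subst (λ u → ¬ ¬ (x u ≈ 0#)) (≡.sym (x∈⁅y⁆⇒x≡y v u∈v)) x_v≈0
    a : Fin (suc (suc k)) → Carrier
    a fzero           = - vs (fsuc fzero) v
    a (fsuc fzero)    = vs fzero v
    a (fsuc (fsuc _)) = 0#
    z : Fin N → Carrier
    z u = sumF F (λ t → a t * vs t u)
    z_v≈0 : z v ≈ 0#
    z_v≈0 = ≈-trans (≈-sym (+-assoc _ _ _)) (≈-trans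
      (+-cong (-x*y+y*x≈0 (vs (fsuc fzero) v) (vs fzero v)) (sumF-zero {k} λ t → zeroˡ (vs (fsuc (fsuc t)) v)))
      (+-identityˡ 0#))
    head-vanishes-at-v : ¬ ¬ (vs fzero v ≈ 0#)
    head-vanishes-at-v ¬head≈0 =
      ¬¬-∀-Fin (vanishes-from-v z (isNullVector-lincomb A a vs null) (λ ¬z → ¬z z_v≈0)) λ z≈0 →
        ¬head≈0 (indep a z≈0 (fsuc fzero))

  zeroForcing≥1 : ∀ A → InS F H A → ∀ x → IsNullVector F A x → ∀ v → ¬ (x v ≈ 0#) →
    ∀ B → ColorsAll H B → 1 ≤ ∣ B ∣
  zeroForcing≥1 A A∈S x null v x_v≉0 B colors with nonempty? B
  ... | yes (u , u∈B) =
    subst (_≤ ∣ B ∣) (∣⁅x⁆∣≡1 u) (p⊆q⇒∣p∣≤∣q∣ λ w∈u → subst (_∈ B) (≡.sym (x∈⁅y⁆⇒x≡y u w∈u)) u∈B)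
  ... | no empty =
    ⊥-elim (colorsAll⇒vanishes A A∈S x null colors (λ u u∈B → ⊥-elim (empty (u , u∈B))) v x_v≉0)

module IntervalForcing (k : ℕ) (H : IntervalHypergraph (suc (suc (suc k)))) where
  open import Data.Nat using (_+_; _*_; _∸_; s≤s⁻¹)
  open import Data.Nat.Properties

  private
    e : ℕ
    e = suc (suc k)
    d : ℕ
    d = suc e
    N : ℕ
    N = n H

  open IntervalEdges e H

  module EdgeMinusVertex (b : ℕ) (fits : b + d ≤ N) (t : Fin d) where
    vertex : Fin d → Fin N
    vertex = edgeVertex b fits

    S : Fin e → Fin N
    S = vertex ∘ punchIn t

    w : Fin N
    w = vertex t

    S-injective : Injective _≡_ _≡_ S
    S-injective eq = punchIn-injective t _ _ (edgeVertex-injective b fits eq)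

    S-image⇒ : ∀ {v} → Image S v → ∃ λ j → j ≢ t × vertex j ≡ v
    S-image⇒ (i , eq) = punchIn t i , punchInᵢ≢i t i , eq

    ⇒S-image : ∀ j → j ≢ t → Image S (vertex j)
    ⇒S-image j j≢t = punchOut (j≢t ∘ ≡.sym) , cong vertex (punchIn-punchOut (j≢t ∘ ≡.sym))

    w∉S : ¬ Image S w
    w∉S w∈S with S-image⇒ w∈S
    ... | j , j≢t , eq = j≢t (edgeVertex-injective b fits eq)

    AddV-S-w⇔edge : ∀ v → AddV H S w v ⇔ InEdge d (suc b) v
    AddV-S-w⇔edge v = mk⇔ to from
      where
      to : AddV H S w v → InEdge d (suc b) v
      to (inj₁ v∈S) with S-image⇒ v∈S
      ... | j , _ , refl = edgeVertex-inEdge b fits j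
      to (inj₂ refl) = edgeVertex-inEdge b fits t
      from : InEdge d (suc b) v → AddV H S w v
      from v∈edge with inEdge⇒edgeVertex b fits v v∈edge
      ... | j , refl with j Fin.≟ t
      ...   | yes refl = inj₂ refl
      ...   | no j≢t   = inj₁ (⇒S-image j j≢t)

    Spans : Fin N → ℕ → Set
    Spans u ℓ' = ∀ v → AddV H S u v ⇔ InEdge d ℓ' v

    spans-same-edge⇒w : ∀ u → Spans u (suc b) → u ≡ w
    spans-same-edge⇒w u spans with Equivalence.from (spans w) (edgeVertex-inEdge b fits t)
    ... | inj₁ w∈S = ⊥-elim (w∉S w∈S)
    ... | inj₂ w≡u = ≡.sym w≡u

    spans-earlier-edge : ∀ u y → y < b → Spans u (suc y) → toℕ t ≡ e × toℕ u < b
    spans-earlier-edge u y y<b spans = t-last , u<b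
      where
      inEdge : ∀ v → AddV H S u v → y ≤ toℕ v × toℕ v ≤ y + e
      inEdge v = Equivalence.to (inEdge-suc⇔ y v) ∘ Equivalence.to (spans v)
      t-last : toℕ t ≡ e
      t-last with fromℕ e Fin.≟ t
      ... | yes last≡t = ≡.trans (cong toℕ (≡.sym last≡t)) (toℕ-fromℕ e)
      ... | no last≢t  =
        ⊥-elim (<⇒≱ y<b (+-cancelʳ-≤ e b y (subst (_≤ y + e) b+e≡last (proj₂ (inEdge _ (inj₁ (⇒S-image _ last≢t)))))))
        where
        b+e≡last : toℕ (vertex (fromℕ e)) ≡ b + e
        b+e≡last = ≡.trans (toℕ-edgeVertex b fits (fromℕ e)) (cong (b +_) (toℕ-fromℕ e))
      y<N : y < N
      y<N = ≤-trans y<b (≤-trans (m≤m+n b d) fits)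
      y-vertex : Fin N
      y-vertex = fromℕ< y<N
      y-start : y ≤ toℕ y-vertex × toℕ y-vertex ≤ y + e
      y-start rewrite toℕ-fromℕ< y<N = ≤-refl , m≤m+n y e
      u<b : toℕ u < b
      u<b with Equivalence.from (spans y-vertex) (Equivalence.from (inEdge-suc⇔ y y-vertex) y-start)
      ... | inj₂ y≡u = subst (_< b) (≡.trans (≡.sym (toℕ-fromℕ< y<N)) (cong toℕ y≡u)) y<b
      ... | inj₁ y∈S with S-image⇒ y∈S
      ...   | j , _ , eq = ⊥-elim (<⇒≱ y<b (subst (b ≤_) b+j≡y (m≤m+n b (toℕ j))))
        where
        b+j≡y : b + toℕ j ≡ y
        b+j≡y = ≡.trans (≡.sym (toℕ-edgeVertex b fits j)) (≡.trans (cong toℕ eq) (toℕ-fromℕ< y<N))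

    spans-later-edge : ∀ u y → b < y → L H (suc y) ≡ true → Spans u (suc y) →
      toℕ t ≡ 0 × y ≡ suc b × toℕ u ≡ b + d
    spans-later-edge u y b<y Ly spans = cong toℕ t≡0 , y≡sb , u≡b+d
      where
      inEdge : ∀ v → AddV H S u v → y ≤ toℕ v × toℕ v ≤ y + e
      inEdge v = Equivalence.to (inEdge-suc⇔ y v) ∘ Equivalence.to (spans v)
      t≡0 : t ≡ fzero
      t≡0 with fzero Fin.≟ t
      ... | yes 0≡t = ≡.sym 0≡t
      ... | no 0≢t  = ⊥-elim (<⇒≱ b<y (subst (y ≤_) (≡.trans (toℕ-edgeVertex b fits fzero) (+-identityʳ b))
                                                   (proj₁ (inEdge _ (inj₁ (⇒S-image fzero 0≢t))))))
      1≢t : fsuc fzero ≢ t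
      1≢t eq with ≡.trans eq t≡0
      ... | ()
      y≡sb : y ≡ suc b
      y≡sb = ≤-antisym (subst (y ≤_) (≡.trans (toℕ-edgeVertex b fits (fsuc fzero)) (+-comm b 1))
                                   (proj₁ (inEdge _ (inj₁ (⇒S-image _ 1≢t))))) b<y
      b+d<N : b + d < N
      b+d<N = subst (λ y → y + d ≤ N) y≡sb (edge-fits y Ly)
      r : Fin N
      r = fromℕ< b+d<N
      r-inEdge : y ≤ toℕ r × toℕ r ≤ y + e
      r-inEdge rewrite toℕ-fromℕ< b+d<N | y≡sb =
        ≤-trans (≤-reflexive (≡.sym (+-comm b 1))) (+-monoʳ-≤ b (s≤s z≤n)) , ≤-reflexive (+-suc b e)
      u≡b+d : toℕ u ≡ b + d
      u≡b+d with Equivalence.from (spans r) (Equivalence.from (inEdge-suc⇔ y r) r-inEdge)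
      ... | inj₂ r≡u = ≡.trans (cong toℕ (≡.sym r≡u)) (toℕ-fromℕ< b+d<N)
      ... | inj₁ r∈S with S-image⇒ r∈S
      ...   | j , _ , eq = ⊥-elim (<⇒≢ (toℕ<n j) (+-cancelˡ-≡ b _ _ b+j≡b+d))
        where
        b+j≡b+d : b + toℕ j ≡ b + d
        b+j≡b+d = ≡.trans (≡.sym (toℕ-edgeVertex b fits j)) (≡.trans (cong toℕ eq) (toℕ-fromℕ< b+d<N))

    forces : ∀ B → L H (suc b) ≡ true → w ∉ B →
      (toℕ t ≡ e → ∀ u → toℕ u < b → u ∈ B) →
      (toℕ t ≡ 0 → L H (suc (suc b)) ≡ true → ∀ u → toℕ u ≡ b + d → u ∈ B) →
      Forces H B S w
    forces B Lb w∉B last-blue-before first-blue-after =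
      S-injective , w∉B , (suc b , Lb , AddV-S-w⇔edge) , unique
      where
      unique : ∀ u → u ∉ B → IsEdge H (AddV H S u) → u ≡ w
      unique u u∉B (ℓ' , Lℓ' , spans) with <-cmp ℓ' (suc b)
      ... | tri≈ _ refl _ = spans-same-edge⇒w u spans
      unique u u∉B (zero , L0 , _) | tri< _ _ _ = ⊥-elim (¬edge-at-0 L0)
      unique u u∉B (suc y , _ , spans) | tri< (s≤s y<b) _ _ with spans-earlier-edge u y y<b spans
      ... | t-last , u<b = ⊥-elim (u∉B (last-blue-before t-last u u<b))
      unique u u∉B (zero , L0 , _) | tri> _ _ _ = ⊥-elim (¬edge-at-0 L0)
      unique u u∉B (suc y , Ly , spans) | tri> _ _ (s≤s b<y) with spans-later-edge u y b<y Ly spans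
      ... | t-first , refl , u≡b+d = ⊥-elim (u∉B (first-blue-after t-first Ly u u≡b+d))

  ForceAvailable : Subset N → Set
  ForceAvailable B = Σ (Fin e → Fin N) λ S → Σ (Fin N) λ w → Forces H B S w

  force-in-edge : ∀ B b → L H (suc b) ≡ true → ∀ w → b ≤ toℕ w → toℕ w ≤ b + e → w ∉ B →
    (toℕ w ≡ b + e → ∀ u → toℕ u < b → u ∈ B) →
    (toℕ w ≡ b → L H (suc (suc b)) ≡ true → ∀ u → toℕ u ≡ b + d → u ∈ B) →
    ForceAvailable B
  force-in-edge B b Lb w b≤w w≤b+e w∉B last-blue-before first-blue-after =
    S , w , subst (λ v → Forces H B S v) vertex-t≡w
      (forces B Lb (subst (_∉ B) (≡.sym vertex-t≡w) w∉B)
        (λ t-last → last-blue-before (≡.trans w≡b+t (cong (b +_) t-last)))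
        (λ t-first → first-blue-after (≡.trans w≡b+t (≡.trans (cong (b +_) t-first) (+-identityʳ b)))))
    where
    t<d : toℕ w ∸ b < d
    t<d = s≤s (subst (toℕ w ∸ b ≤_) (m+n∸m≡n b e) (∸-monoˡ-≤ b w≤b+e))
    t : Fin d
    t = fromℕ< t<d
    open EdgeMinusVertex b (edge-fits b Lb) t using (vertex; S; forces)
    w≡b+t : toℕ w ≡ b + toℕ t
    w≡b+t = ≡.sym (≡.trans (cong (b +_) (toℕ-fromℕ< t<d)) (m+[n∸m]≡n b≤w))
    vertex-t≡w : vertex t ≡ w
    vertex-t≡w = toℕ-injective (≡.trans (toℕ-edgeVertex b (edge-fits b Lb) t) (≡.sym w≡b+t))

  sil-end : ∀ j ℓ → SIL d j ℓ → ℓ + d ≤ j * d + 2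
  sil-end j ℓ (i , i<j , ℓ≡) =
    ≤-trans (+-monoˡ-≤ d (start≤ ℓ≡)) (≤-trans (≤-reflexive block-end) (+-monoˡ-≤ 2 (*-monoˡ-≤ d i<j)))
    where
    start≤ : ℓ ≡ i * d + 1 ⊎ ℓ ≡ i * d + 2 → ℓ ≤ i * d + 2
    start≤ (inj₁ refl) = +-monoʳ-≤ (i * d) (s≤s z≤n)
    start≤ (inj₂ refl) = ≤-refl
    block-end : i * d + 2 + d ≡ suc i * d + 2
    block-end = ≡.trans (+-assoc (i * d) 2 d) (≡.trans (cong (i * d +_) (+-comm 2 d))
                (≡.trans (≡.sym (+-assoc (i * d) d 2)) (cong (_+ 2) (+-comm (i * d) d))))

  sil-≤ : ∀ j ℓ → SIL d j ℓ → ℓ ≤ j * d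
  sil-≤ j ℓ sil = +-cancelʳ-≤ 2 ℓ (j * d) (≤-trans (+-monoʳ-≤ ℓ (s≤s (s≤s z≤n))) (sil-end j ℓ sil))

  sil-suc : ∀ j ℓ → SIL d j ℓ → SIL d (suc j) ℓ
  sil-suc j ℓ (i , i<j , ℓ≡) = i , m<n⇒m<1+n i<j , ℓ≡

  sil-pred : ∀ j ℓ → SIL d (suc j) ℓ → ℓ ≤ j * d → SIL d j ℓ
  sil-pred j ℓ (i , i<sj , ℓ≡) ℓ≤ with i ≟ j
  ... | no i≢j   = i , ≤∧≢⇒< (s≤s⁻¹ i<sj) i≢j , ℓ≡
  ... | yes refl = ⊥-elim (<⇒≱ (s≤s ℓ≤) (start≥ ℓ≡))
    where
    start≥ : ℓ ≡ i * d + 1 ⊎ ℓ ≡ i * d + 2 → suc (i * d) ≤ ℓ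
    start≥ (inj₁ refl) = ≤-reflexive (+-comm 1 (i * d))
    start≥ (inj₂ refl) = ≤-trans (n≤1+n _) (≤-reflexive (+-comm 2 (i * d)))

  SpecialUpTo : ℕ → Set
  SpecialUpTo j = ∀ ℓ → ℓ ≤ j * d → (L H ℓ ≡ true ⇔ SIL d j ℓ)

  specialUpTo-0 : SpecialUpTo 0
  specialUpTo-0 zero _ = mk⇔ (⊥-elim ∘ ¬edge-at-0) λ { (_ , () , _) }

  specialUpTo-suc : ∀ j → SpecialUpTo j → L H (suc (j * d)) ≡ true → L H (suc (suc (j * d))) ≡ true →
    (∀ ℓ → suc (suc (suc (j * d))) ≤ ℓ → ℓ ≤ suc j * d → ¬ (L H ℓ ≡ true)) → SpecialUpTo (suc j)
  specialUpTo-suc j agrees L₁ L₂ gap ℓ ℓ≤ with ℓ ≤? j * d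
  ... | yes ℓ≤jd =
    mk⇔ (sil-suc j ℓ ∘ Equivalence.to (agrees ℓ ℓ≤jd)) (Equivalence.from (agrees ℓ ℓ≤jd) ∘ λ sil → sil-pred j ℓ sil ℓ≤jd)
  ... | no ℓ≰jd with ℓ ≟ suc (j * d)
  ...   | yes refl = mk⇔ (λ _ → j , n<1+n j , inj₁ (+-comm 1 (j * d))) (λ _ → L₁)
  ...   | no ℓ≢₁ with ℓ ≟ suc (suc (j * d))
  ...     | yes refl = mk⇔ (λ _ → j , n<1+n j , inj₂ (+-comm 2 (j * d))) (λ _ → L₂)
  ...     | no ℓ≢₂   = mk⇔ (⊥-elim ∘ gap ℓ beyond ℓ≤) (⊥-elim ∘ not-special)
    where
    beyond : suc (suc (suc (j * d))) ≤ ℓ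
    beyond = ≤∧≢⇒< (≤∧≢⇒< (≰⇒> ℓ≰jd) (ℓ≢₁ ∘ ≡.sym)) (ℓ≢₂ ∘ ≡.sym)
    not-special : ¬ SIL d (suc j) ℓ
    not-special (i , i<sj , ℓ≡) with i ≟ j
    ... | no i≢j = ℓ≰jd (sil-≤ j ℓ (i , ≤∧≢⇒< (s≤s⁻¹ i<sj) i≢j , ℓ≡))
    ... | yes refl with ℓ≡
    ...   | inj₁ ℓ≡₁ = ℓ≢₁ (≡.trans ℓ≡₁ (+-comm (j * d) 1))
    ...   | inj₂ ℓ≡₂ = ℓ≢₂ (≡.trans ℓ≡₂ (+-comm (j * d) 2))

  specialUpTo⇒special : ∀ j → SpecialUpTo j → N ≡ suc (j * d) → IsSpecial H
  specialUpTo⇒special j agrees N≡ = j , ≡.trans N≡ (+-comm 1 (j * d)) , agree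
    where
    edge≤jd : ∀ ℓ → L H ℓ ≡ true → ℓ ≤ j * d
    edge≤jd ℓ Lℓ = +-cancelʳ-≤ 2 ℓ (j * d) (≤-trans (+-monoʳ-≤ ℓ (s≤s (s≤s z≤n))) (≤-trans
      (subst (λ m → ℓ + d ≤ m + 1) N≡ (proj₂ (L-valid H ℓ Lℓ)))
      (≤-reflexive (≡.trans (+-comm (suc (j * d)) 1) (+-comm 2 (j * d))))))
    agree : ∀ ℓ → (L H ℓ ≡ true) ⇔ SIL d j ℓ
    agree ℓ with ℓ ≤? j * d
    ... | yes ℓ≤jd = agrees ℓ ℓ≤jd
    ... | no ℓ≰jd  = mk⇔ (⊥-elim ∘ ℓ≰jd ∘ edge≤jd ℓ) (⊥-elim ∘ ℓ≰jd ∘ sil-≤ j ℓ)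

  -- Edges starting inside the special prefix end by vertex j d, so the edge joining
  -- j d and j d + 1 must start right at j d.
  specialUpTo-next-edge : Connected H → ∀ j → SpecialUpTo j → suc (j * d) < N → L H (suc (j * d)) ≡ true
  specialUpTo-next-edge connected j agrees sjd<N with consecutive-share-edge connected (j * d) sjd<N
  ... | ℓ' , Lℓ' , ℓ'≤ , covers with ℓ' ≤? j * d
  ...   | yes ℓ'≤jd =
    ⊥-elim (<⇒≱ covers (≤-trans (sil-end j ℓ' (Equivalence.to (agrees ℓ' ℓ'≤jd) Lℓ')) (≤-reflexive (+-comm (j * d) 2))))
  ...   | no ℓ'≰jd  = subst (λ ℓ → L H ℓ ≡ true) (≤-antisym ℓ'≤ (≰⇒> ℓ'≰jd)) Lℓ'

  force-interior : ∀ B c → L H (suc c) ≡ true → ∀ w → c < toℕ w → toℕ w < c + e → w ∉ B →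
    ForceAvailable B
  force-interior B c Lc w c<w w<c+e w∉B = force-in-edge B c Lc w (<⇒≤ c<w) (<⇒≤ w<c+e) w∉B
    (λ w≡ → ⊥-elim (<-irrefl w≡ w<c+e)) (λ w≡ → ⊥-elim (<-irrefl (≡.sym w≡) c<w))

  White : Subset N → ℕ → Set
  White B x = Σ (Fin N) λ w → toℕ w ≡ x × w ∉ B

  -- Either j d is forced at once (the second edge of block j is missing, or (j + 1) d is blue),
  -- or (j + 1) d is forced as an interior vertex of an edge starting inside block j, or there
  -- is no such edge.
  block-step : ∀ B j → SpecialUpTo j → L H (suc (j * d)) ≡ true → White B (j * d) →
    ForceAvailable B ⊎ (SpecialUpTo (suc j) × White B (suc j * d))
  block-step B j agrees L₁ (w , w≡b , w∉B) = by-second-edge (L H (suc (suc b)) Bool.≟ true)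
    where
    b : ℕ
    b = j * d
    force-first : (L H (suc (suc b)) ≡ true → ∀ u → toℕ u ≡ b + d → u ∈ B) → ForceAvailable B
    force-first after-blue =
      force-in-edge B b L₁ w (≤-reflexive (≡.sym w≡b)) (subst (_≤ b + e) (≡.sym w≡b) (m≤m+n b e)) w∉B
        (λ w≡b+e → ⊥-elim (<-irrefl (≡.trans (≡.sym w≡b) w≡b+e) (m<m+n b (s≤s z≤n)))) (λ _ → after-blue)
    by-second-edge : Dec (L H (suc (suc b)) ≡ true) →
      ForceAvailable B ⊎ (SpecialUpTo (suc j) × White B (suc j * d))
    by-second-edge (no ¬L₂) = inj₁ (force-first (⊥-elim ∘ ¬L₂))
    by-second-edge (yes L₂) = by-next-vertex (r ∈? B)
      where
      next<N : suc j * d < N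
      next<N = subst (_< N) (+-comm b d) (edge-fits (suc b) L₂)
      r : Fin N
      r = fromℕ< next<N
      by-next-vertex : Dec (r ∈ B) → ForceAvailable B ⊎ (SpecialUpTo (suc j) × White B (suc j * d))
      by-next-vertex (yes r∈B) = inj₁ (force-first λ _ u u≡ →
        subst (_∈ B) (toℕ-injective (≡.trans (toℕ-fromℕ< next<N) (≡.trans (+-comm d b) (≡.sym u≡)))) r∈B)
      by-next-vertex (no r∉B) =
        by-gap (anyUpTo? (λ ℓ → (L H ℓ Bool.≟ true) ×-dec (suc (suc (suc b)) ≤? ℓ)) (suc (suc j * d)))
        where
        by-gap : Dec (∃ λ ℓ → ℓ < suc (suc j * d) × L H ℓ ≡ true × suc (suc (suc b)) ≤ ℓ) →
          ForceAvailable B ⊎ (SpecialUpTo (suc j) × White B (suc j * d))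
        by-gap (yes (zero , _ , _ , ()))
        by-gap (yes (suc c , c<next , Lc , b+2<c)) =
          inj₁ (force-interior B c Lc r (subst (c <_) (≡.sym (toℕ-fromℕ< next<N)) (s≤s⁻¹ c<next)) r<c+e r∉B)
          where
          open ≤-Reasoning
          r<c+e : toℕ r < c + e
          r<c+e = begin-strict
            toℕ r                ≡⟨ toℕ-fromℕ< next<N ⟩
            suc (e + b)          <⟨ n<1+n _ ⟩
            suc (suc (e + b))    ≡⟨ cong suc (+-suc e b) ⟨
            suc (e + suc b)      ≡⟨ +-suc e (suc b) ⟨
            e + suc (suc b)      ≤⟨ +-monoʳ-≤ e (s≤s⁻¹ b+2<c) ⟩
            e + c                ≡⟨ +-comm e c ⟩
            c + e                ∎
        by-gap (no none) =
          inj₂ (specialUpTo-suc j agrees L₁ L₂ (λ ℓ b+2<ℓ ℓ≤ Lℓ → none (ℓ , s≤s ℓ≤ , Lℓ , b+2<ℓ)) ,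
                r , toℕ-fromℕ< next<N , r∉B)

  walk-blocks : Connected H → ¬ IsSpecial H → ∀ B fuel j → N ≤ j * d + fuel → SpecialUpTo j → White B (j * d) →
    ForceAvailable B
  walk-blocks connected ¬special B zero j N≤ agrees (w , w≡jd , _) =
    ⊥-elim (<⇒≱ (subst (_< N) w≡jd (toℕ<n w)) (≤-trans N≤ (≤-reflexive (+-identityʳ (j * d)))))
  walk-blocks connected ¬special B (suc fuel) j N≤ agrees white@(w , w≡jd , _) with suc (j * d) ≟ N
  ... | yes N≡ = ⊥-elim (¬special (specialUpTo⇒special j agrees (≡.sym N≡)))
  ... | no N≢ with block-step B j agrees (specialUpTo-next-edge connected j agrees jd<N) white
    where
    jd<N : suc (j * d) < N
    jd<N = ≤∧≢⇒< (subst (_< N) w≡jd (toℕ<n w)) N≢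
  ...   | inj₁ available = available
  ...   | inj₂ (agrees' , white') = walk-blocks connected ¬special B fuel (suc j) N≤' agrees' white'
    where
    N≤' : N ≤ suc j * d + fuel
    N≤' = ≤-trans N≤ (≤-trans (≤-reflexive (+-suc (j * d) fuel)) (+-monoˡ-≤ fuel (s≤s (m≤n+m (j * d) e))))

  ForcingStart : Subset N → Set
  ForcingStart B = ¬ IsSpecial H ⊎ (∀ v → toℕ v ≡ 0 → v ∈ B)

  smallest-white-forceable : Connected H → ∀ B → ForcingStart B → ∀ w → w ∉ B →
    (∀ u → toℕ u < toℕ w → u ∈ B) → ForceAvailable B
  smallest-white-forceable connected B start w w∉B below-blue =
    by-edge-before (anyUpTo? (λ ℓ → (L H ℓ Bool.≟ true) ×-dec inEdge? ℓ w) (suc (toℕ w))) (toℕ w) refl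
    where
    by-edge-before : Dec (∃ λ ℓ → ℓ < suc (toℕ w) × L H ℓ ≡ true × InEdge d ℓ w) → ∀ x → toℕ w ≡ x →
      ForceAvailable B
    by-edge-before (yes (zero , _ , L0 , _)) _ _ = ⊥-elim (¬edge-at-0 L0)
    by-edge-before (yes (suc b , b<w , Lb , w∈edge)) _ _ =
      force-in-edge B b Lb w b≤w w≤b+e w∉B
        (λ _ u u<b → below-blue u (<-trans u<b (s≤s⁻¹ b<w)))
        (λ w≡b → ⊥-elim (<-irrefl (≡.sym w≡b) (s≤s⁻¹ b<w)))
      where
      b≤w : b ≤ toℕ w
      b≤w = proj₁ (Equivalence.to (inEdge-suc⇔ b w) w∈edge)
      w≤b+e : toℕ w ≤ b + e
      w≤b+e = proj₂ (Equivalence.to (inEdge-suc⇔ b w) w∈edge)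
    by-edge-before (no _) zero w≡0 =
      [ (λ ¬special → walk-blocks connected ¬special B N 0 ≤-refl specialUpTo-0 (w , w≡0 , w∉B))
      , (λ first-blue → ⊥-elim (w∉B (first-blue w w≡0))) ] start
    by-edge-before (no none) (suc x) w≡sx with consecutive-share-edge connected x (subst (_< N) w≡sx (toℕ<n w))
    ... | ℓ' , Lℓ' , ℓ'≤ , covers = ⊥-elim (none (ℓ' , subst (ℓ' <_) (cong suc (≡.sym w≡sx)) (s≤s ℓ'≤) , Lℓ' ,
      subst (λ x → ℓ' ≤ suc x × suc x < ℓ' + d) (≡.sym w≡sx) (≤-trans ℓ'≤ (n≤1+n _) , covers)))

  colorsAll : Connected H → ∀ fuel B → N ∸ ∣ B ∣ ≤ fuel → ForcingStart B → ColorsAll H B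
  colorsAll connected fuel B ≤fuel start with all? (_∈? B)
  ... | yes all-blue = done all-blue
  ... | no ¬all-blue with smallest-outside B ¬all-blue
  ...   | w , w∉B , below-blue with smallest-white-forceable connected B start w w∉B below-blue
  ...     | S , w' , forces = force S w' forces (continue fuel ≤fuel)
    where
    fewer-white : N ∸ ∣ B ∪ ⁅ w' ⁆ ∣ < N ∸ ∣ B ∣
    fewer-white = ∸-monoʳ-< (∣p∣<∣p∪⁅x⁆∣ (proj₁ (proj₂ forces))) (∣p∣≤n (B ∪ ⁅ w' ⁆))
    start' : ForcingStart (B ∪ ⁅ w' ⁆)
    start' = map₂ (λ first-blue v v≡0 → p⊆p∪q ⁅ w' ⁆ (first-blue v v≡0)) start
    continue : ∀ fuel → N ∸ ∣ B ∣ ≤ fuel → ColorsAll H (B ∪ ⁅ w' ⁆)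
    continue zero ≤0 = ⊥-elim (<⇒≱ (≤-trans fewer-white ≤0) z≤n)
    continue (suc fuel) ≤fuel = colorsAll connected fuel (B ∪ ⁅ w' ⁆) (s≤s⁻¹ (≤-trans fewer-white ≤fuel)) start'

module SpecialEdges (k : ℕ) (H : IntervalHypergraph (suc (suc (suc k)))) (special : IsSpecial H) where
  open import Data.Nat using (_+_; _*_; _∸_; _≟_; s≤s⁻¹)
  open import Data.Nat.Properties
  open import Data.Nat.DivMod using (_%_; [m+kn]%n≡m%n; m<n⇒m%n≡m)

  private
    e : ℕ
    e = suc (suc k)
    d : ℕ
    d = suc e
    N : ℕ
    N = n H

  open IntervalEdges e H

  s : ℕ
  s = proj₁ special

  n≡ : N ≡ s * d + 1
  n≡ = proj₁ (proj₂ special)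

  L⇔SIL : ∀ ℓ → (L H ℓ ≡ true) ⇔ SIL d s ℓ
  L⇔SIL = proj₂ (proj₂ special)

  Interior : ℕ → ℕ → Set
  Interior m y = m * d < y × y < m * d + d

  interior-not-multiple : ∀ m y → Interior m y → y % d ≢ 0
  interior-not-multiple m y (md<y , y<end) y%d≡0 = <⇒≱ md<y (m∸n≡0⇒m≤n offset≡0)
    where
    offset+md≡y : (y ∸ m * d) + m * d ≡ y
    offset+md≡y = m∸n+n≡m (<⇒≤ md<y)
    offset<d : y ∸ m * d < d
    offset<d = +-cancelʳ-< (m * d) _ d
      (subst (_< d + m * d) (≡.sym offset+md≡y) (subst (y <_) (+-comm (m * d) d) y<end))
    offset≡0 : y ∸ m * d ≡ 0
    offset≡0 = ≡.trans (≡.sym (m<n⇒m%n≡m offset<d))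
               (≡.trans (≡.sym ([m+kn]%n≡m%n (y ∸ m * d) m d)) (≡.trans (cong (_% d) offset+md≡y) y%d≡0))

  block-fits : ∀ m → m < s → m * d + d < N
  block-fits m m<s = subst (m * d + d <_) (≡.sym n≡)
    (≤-<-trans (≤-trans (≤-reflexive (+-comm (m * d) d)) (*-monoˡ-≤ d m<s)) (m<m+n (s * d) (s≤s z≤n)))

  BlockEnd : ℕ → ℕ → Set
  BlockEnd m x = x ≡ m * d ⊎ x ≡ m * d + d

  InBlock : ℕ → ℕ → Set
  InBlock m x = m * d ≤ x × x ≤ m * d + d

  inBlock-classify : ∀ m x → InBlock m x → Interior m x ⊎ BlockEnd m x
  inBlock-classify m x (md≤x , x≤end) with x ≟ m * d | x ≟ m * d + d
  ... | yes x≡ | _      = inj₂ (inj₁ x≡)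
  ... | no _   | yes x≡ = inj₂ (inj₂ x≡)
  ... | no x≢₁ | no x≢₂ = inj₁ (≤∧≢⇒< md≤x (x≢₁ ∘ ≡.sym) , ≤∧≢⇒< x≤end x≢₂)

  multiple-in-block : ∀ m x → x % d ≡ 0 → InBlock m x → BlockEnd m x
  multiple-in-block m x x%d≡0 x∈block with inBlock-classify m x x∈block
  ... | inj₁ interior = ⊥-elim (interior-not-multiple m x interior x%d≡0)
  ... | inj₂ x-end    = x-end

  InteriorRow : (Fin e → Fin N) → ℕ → Set
  InteriorRow S m = ∀ v → Image S v ⇔ Interior m (toℕ v)

  module BlockWindow (m y : ℕ) (md≤y : m * d ≤ y) (y≤md+1 : y ≤ suc (m * d)) where
    InWindow : ℕ → Set
    InWindow x = y ≤ x × x ≤ y + e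

    inWindow⇒inBlock : ∀ {x} → InWindow x → InBlock m x
    inWindow⇒inBlock (y≤x , x≤y+e) = ≤-trans md≤y y≤x ,
      ≤-trans x≤y+e (≤-trans (+-monoˡ-≤ e y≤md+1) (≤-reflexive (≡.sym (+-suc (m * d) e))))

    interior⇒inWindow : ∀ {x} → Interior m x → InWindow x
    interior⇒inWindow (md<x , x<end) =
      ≤-trans y≤md+1 md<x , ≤-trans (s≤s⁻¹ (≤-trans x<end (≤-reflexive (+-suc (m * d) e)))) (+-monoˡ-≤ e md≤y)

    inWindow-classify : ∀ {x} → InWindow x → Interior m x ⊎ BlockEnd m x
    inWindow-classify x∈ = inBlock-classify m _ (inWindow⇒inBlock x∈)

    -- The window has e + 1 = d vertices, one too few to hold both ends of the block.
    window-one-end : ∀ {a b} → InWindow a → InWindow b → BlockEnd m a → BlockEnd m b → a ≡ b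
    window-one-end _  _  (inj₁ a≡) (inj₁ b≡) = ≡.trans a≡ (≡.sym b≡)
    window-one-end _  _  (inj₂ a≡) (inj₂ b≡) = ≡.trans a≡ (≡.sym b≡)
    window-one-end a∈ b∈ (inj₁ a≡) (inj₂ b≡) =
      ⊥-elim (both-ends (subst (y ≤_) a≡ (proj₁ a∈)) (subst (_≤ y + e) b≡ (proj₂ b∈)))
      where
      both-ends : y ≤ m * d → m * d + d ≤ y + e → ⊥
      both-ends y≤md end≤ = <-irrefl refl (≤-trans (+-monoʳ-< (m * d) (n<1+n e)) (≤-trans end≤ (+-monoˡ-≤ e y≤md)))
    window-one-end a∈ b∈ (inj₂ a≡) (inj₁ b≡) = ≡.sym (window-one-end b∈ a∈ (inj₁ b≡) (inj₂ a≡))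

  window-row-interior : ∀ (S : Fin e → Fin N) q m y md≤y y≤md+1 → toℕ q % d ≡ 0 → ¬ Image S q →
    (∀ v → AddV H S q v ⇔ BlockWindow.InWindow m y md≤y y≤md+1 (toℕ v)) →
    InteriorRow S m
  window-row-interior S q m y md≤y y≤md+1 q%d≡0 q∉S window v = mk⇔ to from
    where
    open BlockWindow m y md≤y y≤md+1
    q∈window : InWindow (toℕ q)
    q∈window = Equivalence.to (window q) (inj₂ refl)
    q-end : BlockEnd m (toℕ q)
    q-end = multiple-in-block m (toℕ q) q%d≡0 (inWindow⇒inBlock q∈window)
    to : Image S v → Interior m (toℕ v)
    to v∈S with inWindow-classify (Equivalence.to (window v) (inj₁ v∈S))
    ... | inj₁ interior = interior
    ... | inj₂ v-end    = ⊥-elim (q∉S (subst (Image S) (toℕ-injective v≡q) v∈S))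
      where
      v≡q : toℕ v ≡ toℕ q
      v≡q = window-one-end (Equivalence.to (window v) (inj₁ v∈S)) q∈window v-end q-end
    from : Interior m (toℕ v) → Image S v
    from interior with Equivalence.from (window v) (interior⇒inWindow interior)
    ... | inj₁ v∈S  = v∈S
    ... | inj₂ refl = ⊥-elim (interior-not-multiple m (toℕ v) interior q%d≡0)

  block-edge-start : ∀ m ℓ → ℓ ≡ m * d + 1 ⊎ ℓ ≡ m * d + 2 →
    ∃ λ y → ℓ ≡ suc y × m * d ≤ y × y ≤ suc (m * d)
  block-edge-start m ℓ (inj₁ refl) = m * d , +-comm (m * d) 1 , ≤-refl , n≤1+n _
  block-edge-start m ℓ (inj₂ refl) = suc (m * d) , +-comm (m * d) 2 , n≤1+n _ , ≤-refl

  joint-edge⇒interior-row : ∀ (S : Fin e → Fin N) q → toℕ q % d ≡ 0 → IsEdge H (AddV H S q) →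
    ∃ λ m → m < s × InteriorRow S m
  joint-edge⇒interior-row S q q%d≡0 edge@(ℓ , Lℓ , spans) with Equivalence.to (L⇔SIL ℓ) Lℓ
  ... | m , m<s , ℓ≡ with block-edge-start m ℓ ℓ≡
  ...   | y , refl , md≤y , y≤md+1 = m , m<s ,
    window-row-interior S q m y md≤y y≤md+1 q%d≡0 (isEdge-AddV⇒∉image S q edge)
      (λ v → ⇔-trans (spans v) (inEdge-suc⇔ y v))

  interior-row-edge⇒end : ∀ S m → m < s → InteriorRow S m → ∀ j → toℕ j % d ≡ 0 → IsEdge H (AddV H S j) →
    BlockEnd m (toℕ j)
  interior-row-edge⇒end S m m<s row j j%d≡0 (zero , L0 , _) = ⊥-elim (¬edge-at-0 L0)
  interior-row-edge⇒end S m m<s row j j%d≡0 (suc y , _ , spans) =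
    multiple-in-block m (toℕ j) j%d≡0 (BlockWindow.inWindow⇒inBlock m y md≤y y≤md+1 (window j (inj₂ refl)))
    where
    window : ∀ v → AddV H S j v → y ≤ toℕ v × toℕ v ≤ y + e
    window v = Equivalence.to (inEdge-suc⇔ y v) ∘ Equivalence.to (spans v)
    interior-in-window : ∀ x (x<N : x < N) → Interior m x → y ≤ x × x ≤ y + e
    interior-in-window x x<N interior = subst (λ x → y ≤ x × x ≤ y + e) (toℕ-fromℕ< x<N)
      (window _ (inj₁ (Equivalence.from (row _) (subst (Interior m) (≡.sym (toℕ-fromℕ< x<N)) interior))))
    first : Interior m (m * d + 1)
    first = m<m+n (m * d) (s≤s z≤n) , +-monoʳ-< (m * d) (s≤s (s≤s z≤n))
    last : Interior m (m * d + e)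
    last = m<m+n (m * d) (s≤s z≤n) , +-monoʳ-< (m * d) (n<1+n e)
    y≤md+1 : y ≤ suc (m * d)
    y≤md+1 = ≤-trans (proj₁ (interior-in-window _ (<-trans (proj₂ first) (block-fits m m<s)) first))
                     (≤-reflexive (+-comm (m * d) 1))
    md≤y : m * d ≤ y
    md≤y = +-cancelʳ-≤ e (m * d) y (proj₂ (interior-in-window _ (<-trans (proj₂ last) (block-fits m m<s)) last))

  end-window : ∀ m → m < s → ∀ x → BlockEnd m x →
    ∃ λ y → L H (suc y) ≡ true ×
      Σ (m * d ≤ y) λ md≤y → Σ (y ≤ suc (m * d)) λ y≤md+1 → BlockWindow.InWindow m y md≤y y≤md+1 x
  end-window m m<s x (inj₁ refl) =
    m * d , Equivalence.from (L⇔SIL _) (m , m<s , inj₁ (+-comm 1 (m * d))) , ≤-refl , n≤1+n _ ,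
    ≤-refl , m≤m+n (m * d) e
  end-window m m<s x (inj₂ refl) =
    suc (m * d) , Equivalence.from (L⇔SIL _) (m , m<s , inj₂ (+-comm 2 (m * d))) , n≤1+n _ , ≤-refl ,
    ≤-trans (≤-reflexive (+-comm 1 (m * d))) (+-monoʳ-≤ (m * d) (s≤s z≤n)) , ≤-reflexive (+-suc (m * d) e)

  interior-row-edge⇐end : ∀ S m → m < s → InteriorRow S m → ∀ j → BlockEnd m (toℕ j) →
    IsEdge H (AddV H S j)
  interior-row-edge⇐end S m m<s row j j-end with end-window m m<s (toℕ j) j-end
  ... | y , Ly , md≤y , y≤md+1 , j∈window =
    suc y , Ly , λ v → ⇔-trans (mk⇔ to from) (⇔-sym (inEdge-suc⇔ y v))
    where
    open BlockWindow m y md≤y y≤md+1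
    to : ∀ {v} → AddV H S j v → InWindow (toℕ v)
    to (inj₁ v∈S) = interior⇒inWindow (Equivalence.to (row _) v∈S)
    to (inj₂ refl) = j∈window
    from : ∀ {v} → InWindow (toℕ v) → AddV H S j v
    from v∈window with inWindow-classify v∈window
    ... | inj₁ interior = inj₁ (Equivalence.from (row _) interior)
    ... | inj₂ v-end = inj₂ (toℕ-injective (window-one-end v∈window j∈window v-end j-end))

  origin : Fin N
  origin = fromℕ< (subst (0 <_) (≡.sym (≡.trans n≡ (+-comm (s * d) 1))) (s≤s z≤n))

  toℕ-origin : toℕ origin ≡ 0
  toℕ-origin = toℕ-fromℕ< _

module SpecialNullVector {c ℓ : Level} (F : Field c ℓ) (k : ℕ) (H : IntervalHypergraph (suc (suc (suc k))))
  (special : IsSpecial H) where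
  open import Data.Nat using (_+_; _*_; _≟_)
  open import Data.Nat.Properties using (m<m+n; +-comm; <-irrefl; <-trans)
  open import Data.Nat.DivMod using (_%_; _/_; m*n%n≡0; m*n/n≡m)
  open Field F using (Carrier; _≈_; 0#; 1#; -_; -‿inverseʳ; *-identityˡ; +-cong; *-cong)
    renaming (_+_ to _⊕_; _*_ to _·_; refl to ≈-refl; sym to ≈-sym; trans to ≈-trans; reflexive to ≈-reflexive)
  open FieldFacts F using (1≉0; sumF-zero; sumF-pair; *-annihˡ; *-annihʳ)

  private
    e : ℕ
    e = suc (suc k)
    d : ℕ
    d = suc e
    N : ℕ
    N = n H

  open IntervalEdges e H
  open IncidenceMatrix F e H
  open SpecialEdges k H special

  sign : ℕ → Carrier
  sign zero    = 1#
  sign (suc m) = - sign m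

  joint-value : ℕ → Carrier
  joint-value y with y % d ≟ 0
  ... | yes _ = sign (y / d)
  ... | no _  = 0#

  x : Fin N → Carrier
  x v = joint-value (toℕ v)

  x-nonjoint : ∀ j → toℕ j % d ≢ 0 → x j ≈ 0#
  x-nonjoint j j%d≢0 with toℕ j % d ≟ 0
  ... | yes j%d≡0 = ⊥-elim (j%d≢0 j%d≡0)
  ... | no _      = ≈-refl

  x-joint : ∀ j m → toℕ j ≡ m * d → x j ≈ sign m
  x-joint j m j≡md with toℕ j % d ≟ 0
  ... | yes _     = ≈-reflexive (cong sign (≡.trans (cong (_/ d) j≡md) (m*n/n≡m m d)))
  ... | no j%d≢0 = ⊥-elim (j%d≢0 (≡.trans (cong (_% d) j≡md) (m*n%n≡0 m d)))

  x-origin≉0 : ¬ (x origin ≈ 0#)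
  x-origin≉0 x≈0 = 1≉0 (≈-trans (≈-sym (x-joint origin 0 toℕ-origin)) x≈0)

  module Row (S : Fin e → Fin N) where
    term : Fin N → Carrier
    term j = incidence (extend F {d} S j) · x j

    term≈0 : ∀ j → (toℕ j % d ≡ 0 → ¬ IsEdge H (AddV H S j)) → term j ≈ 0#
    term≈0 j joint⇒¬edge = by-joint (toℕ j % d ≟ 0)
      where
      by-joint : Dec (toℕ j % d ≡ 0) → term j ≈ 0#
      by-joint (yes j%d≡0) =
        *-annihˡ _ (incidence-nonedge _ (joint⇒¬edge j%d≡0 ∘ Equivalence.to (isEdge-extend⇔ S j)))
      by-joint (no j%d≢0)  = *-annihʳ _ (x-nonjoint j j%d≢0)

    term-edge : ∀ j → IsEdge H (AddV H S j) → term j ≈ x j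
    term-edge j edge =
      ≈-trans (*-cong (incidence-edge _ (Equivalence.from (isEdge-extend⇔ S j) edge)) ≈-refl) (*-identityˡ _)

    -- Only a joint j (a multiple of d) carries a nonzero x_j, and S ∪ {j} is an edge for
    -- a joint j exactly when S is the interior of a block m and j is one of its two ends,
    -- where x takes the opposite values sign m and sign (m + 1).
    interior-row-sum≈0 : ∀ m → m < s → InteriorRow S m → sumF F term ≈ 0#
    interior-row-sum≈0 m m<s row = begin
      sumF F term               ≈⟨ sumF-pair left right left≢right others ⟩
      term left ⊕ term right    ≈⟨ +-cong left-term right-term ⟩
      sign m ⊕ sign (suc m)     ≈⟨ -‿inverseʳ (sign m) ⟩
      0#                        ∎
      where
      open import Relation.Binary.Reasoning.Setoid (Field.setoid F)
      right<N : m * d + d < N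
      right<N = block-fits m m<s
      left : Fin N
      left = fromℕ< (<-trans (m<m+n (m * d) (s≤s z≤n)) right<N)
      left≡ : toℕ left ≡ m * d
      left≡ = toℕ-fromℕ< _
      right : Fin N
      right = fromℕ< right<N
      right≡ : toℕ right ≡ m * d + d
      right≡ = toℕ-fromℕ< right<N
      left≢right : left ≢ right
      left≢right left≡right =
        <-irrefl (≡.trans (≡.sym left≡) (≡.trans (cong toℕ left≡right) right≡)) (m<m+n (m * d) (s≤s z≤n))
      left-term : term left ≈ sign m
      left-term = ≈-trans (term-edge left (interior-row-edge⇐end S m m<s row left (inj₁ left≡)))
                           (x-joint left m left≡)
      right-term : term right ≈ sign (suc m)
      right-term = ≈-trans (term-edge right (interior-row-edge⇐end S m m<s row right (inj₂ right≡)))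
                         (x-joint right (suc m) (≡.trans right≡ (+-comm (m * d) d)))
      others : ∀ j → j ≢ left → j ≢ right → term j ≈ 0#
      others j j≢left j≢right = term≈0 j λ j%d≡0 edge →
        [ (λ j≡ → j≢left (toℕ-injective (≡.trans j≡ (≡.sym left≡))))
        , (λ j≡ → j≢right (toℕ-injective (≡.trans j≡ (≡.sym right≡))))
        ] (interior-row-edge⇒end S m m<s row j j%d≡0 edge)

    row-sum≈0 : sumF F term ≈ 0#
    row-sum≈0 with any? (λ q → (toℕ q % d ≟ 0) ×-dec isEdge? (AddV H S q) (λ v → image? S v ⊎-dec (v Fin.≟ q)))
    ... | no no-joint-edge = sumF-zero λ j → term≈0 j λ j%d≡0 edge → no-joint-edge (j , j%d≡0 , edge)
    ... | yes (q , q%d≡0 , edge) with joint-edge⇒interior-row S q q%d≡0 edge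
    ...   | m , m<s , row = interior-row-sum≈0 m m<s row

  x-null : IsNullVector F incidence x
  x-null S = Row.row-sum≈0 S

theorem3p10 : ∀ {c ℓ : Level} (F : Field c ℓ) (d : ℕ) → 3 ≤ d →
    (H : IntervalHypergraph d) → Connected H →
    (IsSpecial H → MaxNullityIs F H 1 × ZeroForcingIs H 1)
    × (¬ IsSpecial H → MaxNullityIs F H 0 × ZeroForcingIs H 0)
theorem3p10 F (suc (suc (suc k))) (s≤s (s≤s (s≤s _))) H connected = special-case , nonspecial-case
  where
  open NullVectors F using (nonzero⇒linIndep; maxNullityIs-intro)
  open IncidenceMatrix F (suc (suc k)) H using (incidence; incidence∈S)
  open ForcingBound F (suc (suc k)) H using (nullity≤0; nullity≤1; zeroForcing≥1)
  open IntervalForcing k H using (colorsAll)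
  open import Data.Nat.Properties using (m∸n≤m)

  special-case : IsSpecial H → MaxNullityIs F H 1 × ZeroForcingIs H 1
  special-case special =
    maxNullityIs-intro {H = H} incidence incidence∈S
      ((λ _ → x) , (λ _ → x-null) , nonzero⇒linIndep x origin x-origin≉0) (nullity≤1 origin colors) ,
    ((⁅ origin ⁆ , ∣⁅x⁆∣≡1 origin , colors) , zeroForcing≥1 incidence incidence∈S x x-null origin x-origin≉0)
    where
    open SpecialEdges k H special using (origin; toℕ-origin)
    open SpecialNullVector F k H special using (x; x-null; x-origin≉0)
    colors : ColorsAll H ⁅ origin ⁆
    colors = colorsAll connected (n H) ⁅ origin ⁆ (m∸n≤m (n H) ∣ ⁅ origin ⁆ ∣)
      (inj₂ λ v v≡0 → subst (_∈ ⁅ origin ⁆) (toℕ-injective (≡.trans toℕ-origin (≡.sym v≡0))) (x∈⁅x⁆ origin))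

  nonspecial-case : ¬ IsSpecial H → MaxNullityIs F H 0 × ZeroForcingIs H 0
  nonspecial-case ¬special =
    maxNullityIs-intro {H = H} incidence incidence∈S ((λ ()) , (λ ()) , λ _ _ ()) (nullity≤0 colors) ,
    ((Subset.⊥ , ∣⊥∣≡0 (n H) , colors) , λ _ _ → z≤n)
    where
    colors : ColorsAll H Subset.⊥
    colors = colorsAll connected (n H) Subset.⊥ (m∸n≤m (n H) ∣ Subset.⊥ {n H} ∣) (inj₁ ¬special)
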